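{- Let $p\in\mathbb{N}$ and let $G=(L,R,E)$ be a bipartite graph. Then $G$ has the strong $p$-Helly property if and only if $G$ has co-matching index at most $p$.
   Context: A bipartite graph is a triple $G=(L,R,E)$ with $E\subseteq L\times R$. A set $B\subseteq R$ is covered by $A\subseteq L$ if some $a\in A$ is adjacent to all vertices of $B$. Sets $A\subseteq L$, $B\subseteq R$ have the $p$-Helly property if either $B$ is covered by $A$, or $B$ contains a subset of size at most $p$ not covered by $A$. $G$ has the strong $p$-Helly property if all $A\subseteq L$ and $B\subseteq R$ have the $p$-Helly property. Sequences $a_1,\dots,a_n\in L$, $b_1,\dots,b_n\in R$ form a co-matching of order $n$ if $(a_i,b_j)\in E\iff i\ne j$ for all $i,j$; the co-matching index of $G$ is the maximum order of a co-matching in $G$. -}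

module Defs where

open import Data.Nat using (ℕ; _≤_)
open import Data.Fin using (Fin)
open import Data.Fin.Subset using (Subset; _∈_; _⊆_; ∣_∣)
open import Data.Bool using (Bool; true)
open import Data.Product using (Σ; ∃; _×_)
open import Data.Sum using (_⊎_)
open import Relation.Nullary using (¬_)
open import Relation.Binary.PropositionalEquality using (_≡_; _≢_)

-- A finite bipartite graph G = (L, R, E) with L = Fin m, R = Fin n and
-- E ⊆ L × R given by its (decidable) characteristic function.
record BipartiteGraph : Set where
  field
    m : ℕ
    n : ℕ
    E : Fin m → Fin n → Bool

module _ (G : BipartiteGraph) where
  open BipartiteGraph G

  Adj : Fin m → Fin n → Set
  Adj a b = E a b ≡ true

  Covered : Subset m → Subset n → Set
  Covered A B = Σ (Fin m) λ a → a ∈ A × (∀ b → b ∈ B → Adj a b)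

  HasHelly : ℕ → Subset m → Subset n → Set
  HasHelly p A B =
    Covered A B ⊎ Σ (Subset n) λ B′ → B′ ⊆ B × ∣ B′ ∣ ≤ p × ¬ Covered A B′

  StrongHelly : ℕ → Set
  StrongHelly p = ∀ (A : Subset m) (B : Subset n) → HasHelly p A B

  IsCoMatching : (k : ℕ) → (Fin k → Fin m) → (Fin k → Fin n) → Set
  IsCoMatching k a b = ∀ i j → (Adj (a i) (b j) → i ≢ j) × (i ≢ j → Adj (a i) (b j))

  CoMatchingIndex≤ : ℕ → Set
  CoMatchingIndex≤ p = ∀ k (a : Fin k → Fin m) (b : Fin k → Fin n) → IsCoMatching k a b → k ≤ p

-- (⇒) A co-matching a₁..a_k, b₁..b_k gives the pair A = {aᵢ}, B = {bⱼ}: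
--     B is not covered by A (aᵢ misses bᵢ), and every uncovered B′ ⊆ B must
--     contain all bⱼ (otherwise aⱼ would cover B′).  Since the bⱼ are
--     distinct, the p-Helly witness B′ has at least k elements, so k ≤ p.
-- (⇐) If B is not covered by A, shrink B one element at a time while it
--     stays uncovered (well-founded induction on strict inclusion).  The
--     result B′ is critical: removing any x ∈ B′ makes it covered, by some
--     a_x ∈ A.  Then a_x misses x (else it covers B′) and sees every other
--     element of B′, so enumerating B′ yields a co-matching of order ∣ B′ ∣,
--     whence ∣ B′ ∣ ≤ p and B′ witnesses the p-Helly property.

module Submission where

open import Defs
open import Data.Nat using (ℕ; _≤_)
open import Data.Nat.Properties using (≤-trans)
open import Data.Product using (_×_; _,_; Σ; ∃; proj₁; proj₂)
open import Data.Sum using (inj₁; inj₂)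
open import Data.Bool using (true; false)
open import Data.Bool.Properties using (T-≡)
import Data.Bool as Bool
open import Data.Fin using (Fin; zero; suc; _≟_)
open import Data.Fin.Properties using (any?; all?; injective⇒≤; suc-injective)
open import Data.Fin.Subset using (Subset; _∈_; _⊆_; _⊂_; ∣_∣; _-_)
open import Data.Fin.Subset.Properties using (_∈?_; ⊆-refl; ⊆-trans; x∈p⇒p-x⊂p; x∈p∧x≢y⇒x∈p-y)
open import Data.Fin.Subset.Induction using (Acc; acc; ⊂-wellFounded)
open import Data.Vec using (_∷_; tabulate; here; there)
open import Data.Vec.Properties using ([]=⇒lookup; lookup⇒[]=; lookup∘tabulate)
open import Function.Bundles using (Equivalence)
open import Function.Definitions using (Injective)
open import Relation.Nullary using (¬_; Dec; yes; no; contradiction)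
open import Relation.Nullary.Decidable using (⌊_⌋; _×-dec_; _→-dec_; ¬?; toWitness; fromWitness; decidable-stable)
open import Relation.Binary.PropositionalEquality using (_≡_; _≢_; refl; sym; trans; cong; subst; module ≡-Reasoning)

enumerate : ∀ {n} (s : Subset n) → Fin ∣ s ∣ → Fin n
enumerate (true ∷ s) zero = zero
enumerate (true ∷ s) (suc i) = suc (enumerate s i)
enumerate (false ∷ s) i = suc (enumerate s i)

enumerate-∈ : ∀ {n} (s : Subset n) i → enumerate s i ∈ s
enumerate-∈ (true ∷ s) zero = here
enumerate-∈ (true ∷ s) (suc i) = there (enumerate-∈ s i)
enumerate-∈ (false ∷ s) i = there (enumerate-∈ s i)

enumerate-injective : ∀ {n} (s : Subset n) → Injective _≡_ _≡_ (enumerate s)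
enumerate-injective (true ∷ s) {zero} {zero} e = refl
enumerate-injective (true ∷ s) {suc i} {suc j} e = cong suc (enumerate-injective s (suc-injective e))
enumerate-injective (false ∷ s) e = enumerate-injective s (suc-injective e)

position : ∀ {n} (s : Subset n) {x} → x ∈ s → Fin ∣ s ∣
position (true ∷ s) here = zero
position (true ∷ s) (there x∈s) = suc (position s x∈s)
position (false ∷ s) (there x∈s) = position s x∈s

enumerate-position : ∀ {n} (s : Subset n) {x} (x∈s : x ∈ s) → enumerate s (position s x∈s) ≡ x
enumerate-position (true ∷ s) here = refl
enumerate-position (true ∷ s) (there x∈s) = cong suc (enumerate-position s x∈s)
enumerate-position (false ∷ s) (there x∈s) = cong suc (enumerate-position s x∈s)

-- Counting: an injective family of k members of s forces k ≤ ∣ s ∣,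
-- because taking positions is then an injection Fin k → Fin ∣ s ∣.
injective-into⇒≤ : ∀ {k n} (s : Subset n) (f : Fin k → Fin n) →
                   Injective _≡_ _≡_ f → (f∈s : ∀ i → f i ∈ s) → k ≤ ∣ s ∣
injective-into⇒≤ s f f-inj f∈s = injective⇒≤ {f = λ i → position s (f∈s i)} pos-inj
  where
  pos-inj : ∀ {i j} → position s (f∈s i) ≡ position s (f∈s j) → i ≡ j
  pos-inj {i} {j} e = f-inj (begin
    f i                              ≡⟨ sym (enumerate-position s (f∈s i)) ⟩
    enumerate s (position s (f∈s i)) ≡⟨ cong (enumerate s) e ⟩
    enumerate s (position s (f∈s j)) ≡⟨ enumerate-position s (f∈s j) ⟩
    f j                              ∎)
    where open ≡-Reasoning

image : ∀ {k N} → (Fin k → Fin N) → Subset N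
image f = tabulate (λ x → ⌊ any? (λ i → f i ≟ x) ⌋)

∈-image : ∀ {k N} (f : Fin k → Fin N) i → f i ∈ image f
∈-image f i = lookup⇒[]= (f i) (image f)
  (trans (lookup∘tabulate _ (f i))
         (Equivalence.to T-≡ (fromWitness {a? = any? (λ j → f j ≟ f i)} (i , refl))))

image-preimage : ∀ {k N} (f : Fin k → Fin N) {x} → x ∈ image f → ∃ λ i → f i ≡ x
image-preimage f {x} x∈ = toWitness {a? = any? (λ i → f i ≟ x)}
  (Equivalence.from T-≡ (trans (sym (lookup∘tabulate _ x)) ([]=⇒lookup x∈)))

module _ (G : BipartiteGraph) where
  open BipartiteGraph G

  Adj? : ∀ a b → Dec (Adj G a b)
  Adj? a b = E a b Bool.≟ true

  Covered? : ∀ A B → Dec (Covered G A B)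
  Covered? A B = any? (λ a → (a ∈? A) ×-dec all? (λ b → (b ∈? B) →-dec Adj? a b))

  -- In a co-matching the right-hand vertices are distinct: if bᵢ = bⱼ with
  -- i ≠ j then aᵢ would be adjacent to bⱼ = bᵢ.
  coMatching-injective : ∀ {k a b} → IsCoMatching G k a b → Injective _≡_ _≡_ b
  coMatching-injective {a = a} {b} cm {i} {j} bᵢ≡bⱼ with i ≟ j
  ... | yes i≡j = i≡j
  ... | no i≢j = contradiction refl
                   (proj₁ (cm i i) (subst (Adj G (a i)) (sym bᵢ≡bⱼ) (proj₂ (cm i j) i≢j)))

  -- The right-hand side of a co-matching is not covered by its left-hand
  -- side: every aᵢ misses bᵢ.
  coMatching-uncovered : ∀ {k a b} → IsCoMatching G k a b → ¬ Covered G (image a) (image b)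
  coMatching-uncovered {a = a} {b} cm (a′ , a′∈A , covers) with image-preimage a a′∈A
  ... | i , refl = proj₁ (cm i i) (covers (b i) (∈-image b i)) refl

  -- Any set of right-hand co-matching vertices left uncovered by the
  -- left-hand ones contains all bⱼ: a missing bⱼ would let aⱼ cover it.
  uncovered-contains-coMatching : ∀ {k a b} → IsCoMatching G k a b →
    ∀ {B′} → B′ ⊆ image b → ¬ Covered G (image a) B′ → ∀ j → b j ∈ B′
  uncovered-contains-coMatching {a = a} {b} cm {B′} B′⊆ nc j =
    decidable-stable (b j ∈? B′) λ bⱼ∉B′ → nc (a j , ∈-image a j , aⱼ-covers bⱼ∉B′)
    where
    aⱼ-covers : ¬ b j ∈ B′ → ∀ y → y ∈ B′ → Adj G (a j) y
    aⱼ-covers bⱼ∉B′ y y∈B′ with image-preimage b (B′⊆ y∈B′)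
    ... | i , refl = proj₂ (cm j i) λ { refl → bⱼ∉B′ y∈B′ }

  strongHelly⇒coMatchingIndex≤ : ∀ p → StrongHelly G p → CoMatchingIndex≤ G p
  strongHelly⇒coMatchingIndex≤ p helly k a b cm with helly (image a) (image b)
  ... | inj₁ covered = contradiction covered (coMatching-uncovered cm)
  strongHelly⇒coMatchingIndex≤ p helly k a b cm | inj₂ (B′ , B′⊆B , ∣B′∣≤p , nc) =
    ≤-trans (injective-into⇒≤ B′ b (coMatching-injective cm)
                              (uncovered-contains-coMatching cm B′⊆B nc))
            ∣B′∣≤p

  Critical : Subset m → Subset n → Set
  Critical A B = ∀ x → x ∈ B → Covered G A (B - x)

  -- Every uncovered set contains an uncovered critical subset: delete
  -- elements while the set stays uncovered (induction along _⊂_).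
  critical-subset : ∀ {A B} → Acc _⊂_ B → ¬ Covered G A B →
                    Σ (Subset n) λ B′ → B′ ⊆ B × ¬ Covered G A B′ × Critical A B′
  critical-subset {A} {B} (acc smaller) nc
    with any? (λ x → (x ∈? B) ×-dec ¬? (Covered? A (B - x)))
  ... | yes (x , x∈B , nc-x) with critical-subset (smaller (x∈p⇒p-x⊂p x∈B)) nc-x
  ...   | B′ , B′⊆ , nc′ , crit = B′ , ⊆-trans B′⊆ (proj₁ (x∈p⇒p-x⊂p x∈B)) , nc′ , crit
  critical-subset {A} {B} (acc _) nc | no none =
    B , ⊆-refl , nc , λ x x∈B → decidable-stable (Covered? A (B - x)) λ nc-x → none (x , x∈B , nc-x)

  covers-after-removal : ∀ {a B x} → Adj G a x → (∀ y → y ∈ B - x → Adj G a y) →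
                         ∀ y → y ∈ B → Adj G a y
  covers-after-removal {x = x} adj-x adj-rest y y∈B with y ≟ x
  ... | yes refl = adj-x
  ... | no y≢x = adj-rest y (x∈p∧x≢y⇒x∈p-y y∈B y≢x)

  -- An uncovered critical set B yields a co-matching of order ∣ B ∣: pair
  -- each element x of B with a vertex covering B - x.
  critical⇒coMatching : ∀ {A B} → ¬ Covered G A B → Critical A B →
                        ∃ λ a → IsCoMatching G ∣ B ∣ a (enumerate B)
  critical⇒coMatching {A} {B} nc crit = a , λ i j → misses i j , sees i j
    where
    b : Fin ∣ B ∣ → Fin n
    b = enumerate B

    witness : ∀ i → Covered G A (B - b i)
    witness i = crit (b i) (enumerate-∈ B i)

    a : Fin ∣ B ∣ → Fin m
    a i = proj₁ (witness i)

    sees : ∀ i j → i ≢ j → Adj G (a i) (b j)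
    sees i j i≢j = proj₂ (proj₂ (witness i)) (b j)
      (x∈p∧x≢y⇒x∈p-y (enumerate-∈ B j) λ bⱼ≡bᵢ → i≢j (sym (enumerate-injective B bⱼ≡bᵢ)))

    misses : ∀ i j → Adj G (a i) (b j) → i ≢ j
    misses i .i adj refl =
      nc (a i , proj₁ (proj₂ (witness i)) , covers-after-removal adj (proj₂ (proj₂ (witness i))))

  coMatchingIndex≤⇒strongHelly : ∀ p → CoMatchingIndex≤ G p → StrongHelly G p
  coMatchingIndex≤⇒strongHelly p index A B with Covered? A B
  ... | yes covered = inj₁ covered
  ... | no nc with critical-subset (⊂-wellFounded B) nc
  ...   | B′ , B′⊆B , nc′ , crit with critical⇒coMatching nc′ crit
  ...     | a , cm = inj₂ (B′ , B′⊆B , index ∣ B′ ∣ a (enumerate B′) cm , nc′)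

lemma3 : (p : ℕ) (G : BipartiteGraph) → (StrongHelly G p → CoMatchingIndex≤ G p) × (CoMatchingIndex≤ G p → StrongHelly G p)
lemma3 p G = strongHelly⇒coMatchingIndex≤ G p , coMatchingIndex≤⇒strongHelly G p
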